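{- For every integer $M$ there exist a graph $G$ without isolated vertices and a graph $H$ obtained from $G$ by adding a new vertex adjacent to some vertices of $G$ such that $\chi_o(G)-\chi_o(H)\ge M$. That is, the difference $\chi_o(G)-\chi_o(H)$ can be arbitrarily large.
   Context: All graphs are finite, simple and undirected. A proper vertex coloring $\varphi$ of a graph $G$ is called an odd coloring if for every non-isolated vertex $x$ of $G$ there is a color $c$ such that the number of neighbors $y\in N(x)$ with $\varphi(y)=c$ is odd. The odd chromatic number $\chi_o(G)$ is the minimum number of colors in an odd coloring of $G$. -}

module Defs where

open import Data.Nat using (ℕ; zero; suc; _+_; _≤_; _%_)
open import Data.Fin using (Fin; zero; suc; _≟_)
open import Data.Bool using (Bool; true; false; _∧_; if_then_else_)
open import Relation.Nullary using (¬_)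
open import Relation.Nullary.Decidable using (⌊_⌋)
open import Relation.Binary.PropositionalEquality using (_≡_; _≢_)
open import Data.Product using (Σ; ∃; _×_)

record Graph (n : ℕ) : Set where
  field
    adj     : Fin n → Fin n → Bool
    sym     : ∀ x y → adj x y ≡ adj y x
    irrefl  : ∀ x → adj x x ≡ false
open Graph public

count : ∀ {n} → (Fin n → Bool) → ℕ
count {zero}  p = 0
count {suc n} p = (if p zero then 1 else 0) + count (λ i → p (suc i))

Odd : ℕ → Set
Odd m = m % 2 ≡ 1

Isolated : ∀ {n} → Graph n → Fin n → Set
Isolated G x = ∀ y → adj G x y ≡ false

NoIsolatedVertices : ∀ {n} → Graph n → Set
NoIsolatedVertices G = ∀ x → ¬ Isolated G x

colorDegree : ∀ {n k} → Graph n → (Fin n → Fin k) → Fin n → Fin k → ℕ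
colorDegree G φ x c = count (λ y → adj G x y ∧ ⌊ φ y ≟ c ⌋)

Proper : ∀ {n k} → Graph n → (Fin n → Fin k) → Set
Proper G φ = ∀ x y → adj G x y ≡ true → φ x ≢ φ y

IsOddColoring : ∀ {n k} → Graph n → (Fin n → Fin k) → Set
IsOddColoring {n} {k} G φ =
  Proper G φ × (∀ x → ¬ Isolated G x → ∃ λ (c : Fin k) → Odd (colorDegree G φ x c))

OddColorable : ∀ {n} → Graph n → ℕ → Set
OddColorable {n} G k = ∃ λ (φ : Fin n → Fin k) → IsOddColoring G φ

OddChromaticNumber : ∀ {n} → Graph n → ℕ → Set
OddChromaticNumber G k = OddColorable G k × (∀ j → OddColorable G j → k ≤ j)

-- H is obtained from G by adding a new vertex (the vertex zero of Fin (suc n))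
-- adjacent to some (arbitrary) set of vertices of G
ExtendsByOneVertex : ∀ {n} → Graph n → Graph (suc n) → Set
ExtendsByOneVertex {n} G H = ∀ (x y : Fin n) → adj H (suc x) (suc y) ≡ adj G x y

-- Let G be the graph with a vertex for every i < n and a vertex for every ordered pair (a , b),
-- the latter joined to a and b.  In an odd colouring of G a vertex (a , b) with a ≠ b has
-- exactly the two neighbours a and b, so they must get different colours; hence χ_o(G) ≥ n.
-- Adding a vertex adjacent to everything gives H with χ_o(H) ≤ 4: each old vertex sees the new
-- one as its only neighbour of the new colour, and the new vertex sees a singleton colour class
-- of a proper 3-colouring of the bipartite graph G.
module Submission where

open import Defs hiding (sym)
open import Data.Bool using (Bool; true; false; _∧_; _∨_; if_then_else_)
import Data.Bool as Bool
open import Data.Bool.Properties using (¬-not; ∨-zeroʳ; T-≡)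
open import Data.Empty using (⊥-elim)
open import Data.Fin using (Fin; zero; suc; _≟_; punchIn; punchOut)
open import Data.Fin.Patterns using (0F; 1F; 2F)
open import Data.Fin.Properties
  using (suc-injective; punchInᵢ≢i; punchIn-injective; punchIn-punchOut; any?; all?; ¬∀⟶∃¬;
         injective⇒≤; +↔⊎; *↔×)
open import Data.Integer as ℤ using (ℤ; +_; -[1+_]; _-_; _≤_; _⊖_; ∣_∣; +≤+; -≤+)
open import Data.Integer.Properties using (m-n≡m⊖n; ⊖-≥)
import Data.Integer.Properties as ℤ
open import Data.Nat as ℕ using (ℕ; zero; suc; _+_; _*_; _∸_; _%_)
open import Data.Nat.Properties
  using (+-comm; +-monoʳ-≤; n≮n; m+n≤o⇒m≤o∸n; m+n≤o⇒n≤o; +-commutativeSemigroup)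
open import Algebra.Properties.CommutativeSemigroup +-commutativeSemigroup using (x∙yz≈y∙xz)
import Data.Nat.Properties as ℕ
open import Data.Product using (Σ; ∃; _×_; _,_; proj₁; uncurry)
open import Data.Sum using (_⊎_; inj₁; inj₂)
open import Data.Sum.Properties using (inj₁-injective)
import Data.Sum as Sum
open import Data.Sum.Function.Propositional using (_⊎-↔_)
open import Data.Vec.Functional using (_∷_; head; tail)
open import Data.Vec.Functional.Properties using (∷-cong)
open import Function using (_∘_; id; _↔_; Inverse; Injective)
open import Function.Bundles using (Equivalence)
open import Function.Properties.Inverse using (↔-refl; ↔-trans)
open import Relation.Nullary using (¬_; Dec; yes; no; ¬?; _×-dec_; _→-dec_; contradiction)
open import Relation.Nullary.Decidable
  using (⌊_⌋; map′; toWitness; isYes≗does; ⌊⌋-map′; dec-true; dec-false)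
open import Relation.Binary.PropositionalEquality
  using (_≡_; _≢_; _≗_; refl; sym; trans; cong; cong₂; subst; module ≡-Reasoning)

private
  variable
    n k : ℕ

⌊⌋≡true⇒ : ∀ {A : Set} (a? : Dec A) → ⌊ a? ⌋ ≡ true → A
⌊⌋≡true⇒ a? = toWitness ∘ Equivalence.from T-≡

⌊⌋≡true : ∀ {A : Set} (a? : Dec A) → A → ⌊ a? ⌋ ≡ true
⌊⌋≡true a? a = trans (isYes≗does a?) (dec-true a? a)

⌊⌋≡false : ∀ {A : Set} (a? : Dec A) → ¬ A → ⌊ a? ⌋ ≡ false
⌊⌋≡false a? ¬a = trans (isYes≗does a?) (dec-false a? ¬a)

∧-true : ∀ {a b} → a ∧ b ≡ true → a ≡ true × b ≡ true
∧-true {true} {true} _ = refl , refl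

count-cong : {p q : Fin n → Bool} → p ≗ q → count p ≡ count q
count-cong {zero}  _   = refl
count-cong {suc n} p≗q =
  cong₂ _+_ (cong (λ b → if b then 1 else 0) (p≗q zero)) (count-cong (p≗q ∘ suc))

count-≡0 : {p : Fin n → Bool} → (∀ y → p y ≡ false) → count p ≡ 0
count-≡0 {zero}  _  = refl
count-≡0 {suc n} p≡false rewrite p≡false zero = count-≡0 (p≡false ∘ suc)

count-punchIn : (p : Fin (suc n) → Bool) (a : Fin (suc n)) →
                count p ≡ (if p a then 1 else 0) + count (p ∘ punchIn a)
count-punchIn p zero = refl
count-punchIn {suc n} p (suc a) = begin
  ⟦ p zero ⟧ + count (p ∘ suc)
    ≡⟨ cong (λ m → ⟦ p zero ⟧ + m) (count-punchIn (p ∘ suc) a) ⟩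
  ⟦ p zero ⟧ + (⟦ p (suc a) ⟧ + count (p ∘ suc ∘ punchIn a))
    ≡⟨ x∙yz≈y∙xz ⟦ p zero ⟧ ⟦ p (suc a) ⟧ _ ⟩
  ⟦ p (suc a) ⟧ + (⟦ p zero ⟧ + count (p ∘ suc ∘ punchIn a)) ∎
  where
  open ≡-Reasoning
  ⟦_⟧ : Bool → ℕ
  ⟦ b ⟧ = if b then 1 else 0

count-≡1 : {p : Fin n → Bool} (a : Fin n) → p a ≡ true → (∀ y → p y ≡ true → y ≡ a) →
           count p ≡ 1
count-≡1 {suc n} {p} a pa onlyA rewrite count-punchIn p a | pa = cong suc (count-≡0 elsewhere)
  where
  elsewhere : ∀ y → p (punchIn a y) ≡ false
  elsewhere y = ¬-not (punchInᵢ≢i a y ∘ onlyA (punchIn a y))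

count-≡2 : {p : Fin n → Bool} {a b : Fin n} → a ≢ b → p a ≡ true → p b ≡ true →
           (∀ y → p y ≡ true → y ≡ a ⊎ y ≡ b) → count p ≡ 2
count-≡2 {suc n} {p} {a} {b} a≢b pa pb onlyAB rewrite count-punchIn p a | pa =
  cong suc (count-≡1 (punchOut a≢b) (trans (cong p (punchIn-punchOut a≢b)) pb) onlyB)
  where
  onlyB : ∀ y → p (punchIn a y) ≡ true → y ≡ punchOut a≢b
  onlyB y py with onlyAB (punchIn a y) py
  ... | inj₁ ≡a = ⊥-elim (punchInᵢ≢i a y ≡a)
  ... | inj₂ ≡b = punchIn-injective a y _ (trans ≡b (sym (punchIn-punchOut a≢b)))

module _ (G : Graph n) {φ : Fin n → Fin k} {x : Fin n} where

  private
    coloured : ∀ {y c} → adj G x y ≡ true → φ y ≡ c → (adj G x y ∧ ⌊ φ y ≟ c ⌋) ≡ true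
    coloured {y} {c} xy φy≡c rewrite xy = ⌊⌋≡true (φ y ≟ c) φy≡c

    coloured⁻ : ∀ {y c} → (adj G x y ∧ ⌊ φ y ≟ c ⌋) ≡ true → adj G x y ≡ true × φ y ≡ c
    coloured⁻ {y} {c} e = let xy , φy≟c = ∧-true e in xy , ⌊⌋≡true⇒ (φ y ≟ c) φy≟c

  colorDegree-≡0 : ∀ {c} → (∀ y → adj G x y ≡ true → φ y ≢ c) → colorDegree G φ x c ≡ 0
  colorDegree-≡0 {c} noneOfColour = count-≡0 uncoloured
    where
    uncoloured : ∀ y → (adj G x y ∧ ⌊ φ y ≟ c ⌋) ≡ false
    uncoloured y with adj G x y in xy
    ... | false = refl
    ... | true  = ⌊⌋≡false (φ y ≟ c) (noneOfColour y xy)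

  colorDegree-≡1 : ∀ {v c} → adj G x v ≡ true → φ v ≡ c →
                   (∀ y → adj G x y ≡ true → φ y ≡ c → y ≡ v) → colorDegree G φ x c ≡ 1
  colorDegree-≡1 xv φv≡c onlyV =
    count-≡1 _ (coloured xv φv≡c) λ y → uncurry (onlyV y) ∘ coloured⁻

  colorDegree-≡2 : ∀ {u v c} → u ≢ v → adj G x u ≡ true → adj G x v ≡ true →
                   φ u ≡ c → φ v ≡ c →
                   (∀ y → adj G x y ≡ true → y ≡ u ⊎ y ≡ v) → colorDegree G φ x c ≡ 2
  colorDegree-≡2 u≢v xu xv φu≡c φv≡c onlyUV =
    count-≡2 u≢v (coloured xu φu≡c) (coloured xv φv≡c) λ y → onlyUV y ∘ proj₁ ∘ coloured⁻

odd-colorDegree-of-unique : (G : Graph n) {φ : Fin n → Fin k} {x v : Fin n} → adj G x v ≡ true →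
  (∀ y → adj G x y ≡ true → φ y ≡ φ v → y ≡ v) → Odd (colorDegree G φ x (φ v))
odd-colorDegree-of-unique G xv onlyV rewrite colorDegree-≡1 G xv refl onlyV = refl

degreeTwo-distinctColours : (G : Graph n) {φ : Fin n → Fin k} → IsOddColoring G φ →
  {x u v : Fin n} → u ≢ v → adj G x u ≡ true → adj G x v ≡ true →
  (∀ y → adj G x y ≡ true → y ≡ u ⊎ y ≡ v) → φ u ≢ φ v
degreeTwo-distinctColours G {φ} (_ , odd) {x} {u} {v} u≢v xu xv onlyUV φu≡φv
  with odd x (λ isolated → contradiction (trans (sym (isolated u)) xu) λ ())
... | c , oddDegree with φ u ≟ c
... | yes φu≡c =
  contradiction (subst Odd deg≡2 oddDegree) λ ()
  where
  deg≡2 : colorDegree G φ x c ≡ 2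
  deg≡2 = colorDegree-≡2 G u≢v xu xv φu≡c (trans (sym φu≡φv) φu≡c) onlyUV
... | no φu≢c =
  contradiction (subst Odd (colorDegree-≡0 G notC) oddDegree) λ ()
  where
  notC : ∀ y → adj G x y ≡ true → φ y ≢ c
  notC y xy with onlyUV y xy
  ... | inj₁ refl = φu≢c
  ... | inj₂ refl = φu≢c ∘ trans φu≡φv

neighbour : (G : Graph n) (x : Fin n) → ¬ Isolated G x → ∃ λ y → adj G x y ≡ true
neighbour G x nonIsolated =
  let y , xy≢false = ¬∀⟶∃¬ _ _ (λ y → adj G x y Bool.≟ false) nonIsolated
  in y , ¬-not xy≢false

id-isOddColoring : (G : Graph n) → IsOddColoring G id
id-isOddColoring G = proper , λ x nonIsolated →
  let y , xy = neighbour G x nonIsolated in y , odd-colorDegree-of-unique G xy (λ _ _ → id)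
  where
  proper : Proper G id
  proper x .x xx refl = contradiction (trans (sym xx) (irrefl G x)) λ ()

isOddColoring-resp-≗ : (G : Graph n) {φ ψ : Fin n → Fin k} → φ ≗ ψ →
                       IsOddColoring G φ → IsOddColoring G ψ
isOddColoring-resp-≗ G φ≗ψ (proper , odd) =
  (λ x y xy ψx≡ψy → proper x y xy (trans (φ≗ψ x) (trans ψx≡ψy (sym (φ≗ψ y))))) ,
  λ x nonIsolated → let c , oddDegree = odd x nonIsolated in
    c , subst Odd (count-cong λ y → cong (λ z → adj G x y ∧ ⌊ z ≟ c ⌋) (φ≗ψ y)) oddDegree

isOddColoring? : (G : Graph n) (φ : Fin n → Fin k) → Dec (IsOddColoring G φ)
isOddColoring? G φ =
  (all? λ x → all? λ y → (adj G x y Bool.≟ true) →-dec ¬? (φ x ≟ φ y)) ×-dec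
  (all? λ x → ¬? (all? λ y → adj G x y Bool.≟ false) →-dec
              any? λ c → colorDegree G φ x c % 2 ℕ.≟ 1)

anyFunction? : {P : (Fin n → Fin k) → Set} → (∀ {φ ψ} → φ ≗ ψ → P φ → P ψ) →
               (∀ φ → Dec (P φ)) → Dec (∃ P)
anyFunction? {zero} resp P? = map′ (_ ,_) (λ (φ , p) → resp (λ ()) p) (P? λ ())
anyFunction? {suc n} resp P? =
  map′ (λ (c , φ , p) → c ∷ φ , p)
       (λ (φ , p) → head φ , tail φ , resp (∷-cong refl λ _ → refl) p)
       (any? λ c → anyFunction? (resp ∘ ∷-cong refl) (P? ∘ (c ∷_)))

oddColorable? : (G : Graph n) (k : ℕ) → Dec (OddColorable G k)
oddColorable? G k = anyFunction? (isOddColoring-resp-≗ G) (isOddColoring? G)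

Least : (ℕ → Set) → ℕ → Set
Least P m = P m × (∀ j → P j → m ℕ.≤ j)

module _ {P : ℕ → Set} (P? : ∀ m → Dec (P m)) where

  private
    least-or-bounded : ∀ b → ∃ (Least P) ⊎ (∀ j → P j → b ℕ.≤ j)
    least-or-bounded zero = inj₂ λ _ _ → ℕ.z≤n
    least-or-bounded (suc b) with least-or-bounded b
    ... | inj₁ least = inj₁ least
    ... | inj₂ b≤ with P? b
    ...   | yes pb = inj₁ (b , pb , b≤)
    ...   | no ¬pb = inj₂ λ j pj → ℕ.≤∧≢⇒< (b≤ j pj) λ { refl → ¬pb pj }

  least : ∀ {k} → P k → ∃ (Least P)
  least {k} pk with least-or-bounded (suc k)
  ... | inj₁ l  = l
  ... | inj₂ k< = contradiction (k< k pk) (n≮n k)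

oddChromaticNumber-exists : (G : Graph n) → ∃ (OddChromaticNumber G)
oddChromaticNumber-exists G = least (oddColorable? G) (id , id-isOddColoring G)

cone : Graph n → Graph (suc n)
cone G = record { adj = adjC ; sym = symC ; irrefl = irreflC }
  where
  adjC : Fin (suc _) → Fin (suc _) → Bool
  adjC zero    zero    = false
  adjC zero    (suc _) = true
  adjC (suc _) zero    = true
  adjC (suc x) (suc y) = adj G x y

  symC : ∀ x y → adjC x y ≡ adjC y x
  symC zero    zero    = refl
  symC zero    (suc _) = refl
  symC (suc _) zero    = refl
  symC (suc x) (suc y) = Graph.sym G x y

  irreflC : ∀ x → adjC x x ≡ false
  irreflC zero    = refl
  irreflC (suc x) = irrefl G x

cone-extends : (G : Graph n) → ExtendsByOneVertex G (cone G)
cone-extends G _ _ = refl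

cone-oddColorable : (G : Graph n) (φ : Fin n → Fin k) → Proper G φ →
  (c : Fin k) → Odd (count λ y → ⌊ φ y ≟ c ⌋) → OddColorable (cone G) (suc k)
cone-oddColorable G φ proper c oddClass = ψ , properψ , odd
  where
  ψ : Fin (suc _) → Fin (suc _)
  ψ zero    = zero
  ψ (suc x) = suc (φ x)

  properψ : Proper (cone G) ψ
  properψ zero    zero    ()
  properψ zero    (suc _) _  ()
  properψ (suc _) zero    _  ()
  properψ (suc x) (suc y) xy = proper x y xy ∘ suc-injective

  odd : ∀ x → ¬ Isolated (cone G) x → ∃ λ c → Odd (colorDegree (cone G) ψ x c)
  odd zero    _ = suc c , subst Odd (count-cong λ y → sym (⌊⌋-map′ _ _ (φ y ≟ c))) oddClass
  odd (suc x) _ = zero , odd-colorDegree-of-unique (cone G) {x = suc x} {v = zero} refl onlyApex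
    where
    onlyApex : ∀ y → adj (cone G) (suc x) y ≡ true → ψ y ≡ zero → y ≡ zero
    onlyApex zero    _ _ = refl
    onlyApex (suc _) _ ()

module PairGraph (n : ℕ) where

  Vertex : Set
  Vertex = Fin n ⊎ (Fin n × Fin n)

  pattern point i  = inj₁ i
  pattern pair a b = inj₂ (a , b)

  _~_ : Vertex → Vertex → Bool
  point i  ~ pair a b = ⌊ i ≟ a ⌋ ∨ ⌊ i ≟ b ⌋
  pair a b ~ point i  = ⌊ i ≟ a ⌋ ∨ ⌊ i ≟ b ⌋
  point _  ~ point _  = false
  pair _ _ ~ pair _ _ = false

  ~-sym : ∀ v w → v ~ w ≡ w ~ v
  ~-sym (point _)  (point _)  = refl
  ~-sym (point _)  (pair _ _) = refl
  ~-sym (pair _ _) (point _)  = refl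
  ~-sym (pair _ _) (pair _ _) = refl

  ~-irrefl : ∀ v → v ~ v ≡ false
  ~-irrefl (point _)  = refl
  ~-irrefl (pair _ _) = refl

  pair~left : ∀ a b → pair a b ~ point a ≡ true
  pair~left a b rewrite ⌊⌋≡true (a ≟ a) refl = refl

  pair~right : ∀ a b → pair a b ~ point b ≡ true
  pair~right a b rewrite ⌊⌋≡true (b ≟ b) refl = ∨-zeroʳ _

  pair-neighbours : ∀ a b w → pair a b ~ w ≡ true → w ≡ point a ⊎ w ≡ point b
  pair-neighbours a b (point i) e with i ≟ a | i ≟ b
  ... | yes refl | _        = inj₁ refl
  ... | no _     | yes refl = inj₂ refl
  pair-neighbours a b (point i) () | no _ | no _

  hasNeighbour : ∀ v → ∃ λ w → v ~ w ≡ true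
  hasNeighbour (point i)  = pair i i , pair~left i i
  hasNeighbour (pair a b) = point a , pair~left a b

  order : ℕ
  order = n + n * n

  vertexCode : Fin order ↔ Vertex
  vertexCode = ↔-trans +↔⊎ (↔-refl ⊎-↔ *↔×)

  decode : Fin order → Vertex
  decode = Inverse.to vertexCode

  encode : Vertex → Fin order
  encode = Inverse.from vertexCode

  decode-encode : ∀ v → decode (encode v) ≡ v
  decode-encode = Inverse.strictlyInverseˡ vertexCode

  encode-decode : ∀ x → encode (decode x) ≡ x
  encode-decode = Inverse.strictlyInverseʳ vertexCode

  graph : Graph order
  graph = record
    { adj    = λ x y → decode x ~ decode y
    ; sym    = λ x y → ~-sym (decode x) (decode y)
    ; irrefl = λ x → ~-irrefl (decode x)
    }

  adj-encode : ∀ v w → adj graph (encode v) (encode w) ≡ v ~ w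
  adj-encode v w = cong₂ _~_ (decode-encode v) (decode-encode w)

  adj-encodeˡ : ∀ v y → adj graph (encode v) y ≡ v ~ decode y
  adj-encodeˡ v y = cong (_~ decode y) (decode-encode v)

  adj-encodeʳ : ∀ x w → adj graph x (encode w) ≡ decode x ~ w
  adj-encodeʳ x w = cong (decode x ~_) (decode-encode w)

  decode≡⇒≡encode : ∀ {x v} → decode x ≡ v → x ≡ encode v
  decode≡⇒≡encode {x} refl = sym (encode-decode x)

  encode-injective : Injective _≡_ _≡_ encode
  encode-injective {v} {w} e = trans (sym (decode-encode v)) (trans (cong decode e) (decode-encode w))

  noIsolatedVertices : NoIsolatedVertices graph
  noIsolatedVertices x isolated =
    let w , xw = hasNeighbour (decode x)
    in contradiction (trans (sym (isolated (encode w))) (trans (adj-encodeʳ x w) xw)) λ ()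

  n≤oddColours : {φ : Fin order → Fin k} → IsOddColoring graph φ → n ℕ.≤ k
  n≤oddColours {φ = φ} oddColouring = injective⇒≤ {f = φ ∘ encode ∘ point} distinct
    where
    distinct : Injective _≡_ _≡_ (φ ∘ encode ∘ point)
    distinct {a} {b} φa≡φb with a ≟ b
    ... | yes a≡b = a≡b
    ... | no a≢b  = ⊥-elim (degreeTwo-distinctColours graph oddColouring {x = encode (pair a b)}
      (a≢b ∘ inj₁-injective ∘ encode-injective)
      (trans (adj-encode (pair a b) (point a)) (pair~left a b))
      (trans (adj-encode (pair a b) (point b)) (pair~right a b))
      onlyEndpoints φa≡φb)
      where
      onlyEndpoints : ∀ y → adj graph (encode (pair a b)) y ≡ true →
                      y ≡ encode (point a) ⊎ y ≡ encode (point b)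
      onlyEndpoints y xy = Sum.map decode≡⇒≡encode decode≡⇒≡encode
        (pair-neighbours a b (decode y) (trans (sym (adj-encodeˡ (pair a b) y)) xy))

cone-pairGraph-oddColorable : ∀ k → OddColorable (cone (PairGraph.graph (suc k))) 4
cone-pairGraph-oddColorable k =
  cone-oddColorable graph (colour ∘ decode) (λ x y → proper (decode x) (decode y)) 2F
    (subst Odd (sym (count-≡1 (encode (point 0F)) marked onlyMarked)) refl)
  where
  open PairGraph (suc k)

  colour : Vertex → Fin 3
  colour (point zero)    = 2F
  colour (point (suc _)) = 0F
  colour (pair _ _)      = 1F

  proper : ∀ v w → v ~ w ≡ true → colour v ≢ colour w
  proper (point _)       (point _)       ()
  proper (pair _ _)      (pair _ _)      ()
  proper (point zero)    (pair _ _)      _ ()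
  proper (point (suc _)) (pair _ _)      _ ()
  proper (pair _ _)      (point zero)    _ ()
  proper (pair _ _)      (point (suc _)) _ ()

  marked : ⌊ colour (decode (encode (point 0F))) ≟ 2F ⌋ ≡ true
  marked rewrite decode-encode (point 0F) = refl

  colour≡2F : ∀ v → ⌊ colour v ≟ 2F ⌋ ≡ true → v ≡ point 0F
  colour≡2F (point zero) _ = refl
  colour≡2F (point (suc _)) ()
  colour≡2F (pair _ _)      ()

  onlyMarked : ∀ y → ⌊ colour (decode y) ≟ 2F ⌋ ≡ true → y ≡ encode (point 0F)
  onlyMarked y = decode≡⇒≡encode ∘ colour≡2F (decode y)

i≤+∣i∣ : ∀ i → i ≤ + ∣ i ∣
i≤+∣i∣ (+ _)    = ℤ.≤-refl
i≤+∣i∣ -[1+ _ ] = -≤+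

≤-minus : ∀ (M : ℤ) {a b : ℕ} → ∣ M ∣ + b ℕ.≤ a → M ≤ + a - + b
≤-minus M {a} {b} ∣M∣+b≤a = begin
  M           ≤⟨ i≤+∣i∣ M ⟩
  + ∣ M ∣     ≤⟨ +≤+ (m+n≤o⇒m≤o∸n ∣ M ∣ ∣M∣+b≤a) ⟩
  + (a ∸ b)   ≡⟨ ⊖-≥ (m+n≤o⇒n≤o ∣ M ∣ ∣M∣+b≤a) ⟨
  a ⊖ b       ≡⟨ m-n≡m⊖n a b ⟨
  + a - + b   ∎
  where open ℤ.≤-Reasoning

mainTheorem4 : ∀ (M : ℤ) → ∃ λ (n : ℕ) → Σ (Graph n) λ G → Σ (Graph (suc n)) λ H →
    NoIsolatedVertices G × ExtendsByOneVertex G H ×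
    (∃ λ (kG : ℕ) → ∃ λ (kH : ℕ) →
      OddChromaticNumber G kG × OddChromaticNumber H kH × M ≤ (+ kG) - (+ kH))
mainTheorem4 M =
  order , graph , cone graph , noIsolatedVertices , cone-extends graph ,
  gap (oddChromaticNumber-exists graph) (oddChromaticNumber-exists (cone graph))
  where
  open PairGraph (4 + ∣ M ∣)

  gap : ∃ (OddChromaticNumber graph) → ∃ (OddChromaticNumber (cone graph)) →
        ∃ λ kG → ∃ λ kH → OddChromaticNumber graph kG × OddChromaticNumber (cone graph) kH ×
                          M ≤ + kG - + kH
  gap (kG , χG@((_ , oddColouring) , _)) (kH , χH@(_ , leastH)) =
    kG , kH , χG , χH , ≤-minus M (begin
    ∣ M ∣ + kH ≤⟨ +-monoʳ-≤ ∣ M ∣ (leastH 4 (cone-pairGraph-oddColorable (3 + ∣ M ∣))) ⟩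
    ∣ M ∣ + 4  ≡⟨ +-comm ∣ M ∣ 4 ⟩
    4 + ∣ M ∣  ≤⟨ n≤oddColours oddColouring ⟩
    kG         ∎)
    where open ℕ.≤-Reasoning
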